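{- For all $\sigma\in\Sigma_k$, $\tau\in\Sigma_l$ and $\epsilon\in Sh(k,l)$, $$\epsilon^{ -1}.\left(\mathbb{T}^\sigma\,\mathbb{T}^\tau\right)=\sum_{\zeta\in Sh(k,l)}\mathbb{T}^{\zeta^{ -1}\circ(\sigma\otimes\tau)\circ\epsilon}.$$
   Context: Rooted forests have edges oriented towards the roots; for distinct vertices, $i\twoheadrightarrow j$ means there is an oriented path from $i$ to $j$. An ordered forest with $n$ vertices is a rooted forest with vertex set identified with $\{1,\dots,n\}$, up to isomorphism preserving roots and labels; it is heap-ordered if $i\twoheadrightarrow j$ implies $i>j$. $\mathbf{H}_o$ (resp. $\mathbf{H}_{ho}$) is the vector space with basis ordered (resp. heap-ordered) forests; $\mathbf{H}_o(n)$ is the span of ordered forests with $n$ vertices. Product: $\mathbb{F}\mathbb{G}$ is the disjoint union with the labels of $\mathbb{G}$ shifted by the number of vertices of $\mathbb{F}$; coproduct $\Delta(\mathbb{F})=\sum_{\vec v}\mathrm{Roo}_{\vec v}\mathbb{F}\otimes\mathrm{Lea}_{\vec v}\mathbb{F}$ over admissible cuts (sets of vertices pairwise unrelated by $\twoheadrightarrow$), $\mathrm{Lea}_{\vec v}\mathbb{F}$ being the subforest on $\vec v$ and all vertices above it, $\mathrm{Roo}_{\vec v}\mathbb{F}$ the rest, relabelled increasingly; $\mathbf{H}_{ho}$ is a Hopf subalgebra of the Hopf algebra $\mathbf{H}_o$. The symmetric group $\Sigma_n$ acts on ordered forests with $n$ vertices by relabelling: $\sigma.\mathbb{F}$ is $\mathbb{F}$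 with the vertex labelled $i$ relabelled $\sigma(i)$; this action is extended linearly to $\mathbf{H}_o(n)$. $\mathbf{FQSym}$ has basis $\bigsqcup_n\Sigma_n$ (composition $(\sigma\circ\tau)(i)=\sigma(\tau(i))$); for $\sigma\in\Sigma_k,\tau\in\Sigma_l$, $(\sigma\otimes\tau)(i)=\sigma(i)$ for $i\le k$ and $(\sigma\otimes\tau)(k+j)=k+\tau(j)$; $Sh(k,l)=\{\zeta\in\Sigma_{k+l}:\zeta^{ -1}(1)<\dots<\zeta^{ -1}(k),\ \zeta^{ -1}(k+1)<\dots<\zeta^{ -1}(k+l)\}$; product $\sigma\cdot\tau=\sum_{\epsilon\in Sh(k,l)}(\sigma\otimes\tau)\circ\epsilon$; coproduct $\Delta(\sigma)=\sum_{k=0}^n\sigma_1\otimes\sigma_2$ over the unique decompositions $\sigma=\zeta^{ -1}\circ(\sigma_1\otimes\sigma_2)$, $\zeta\in Sh(k,n-k)$. The linear map $\Theta:\mathbf{H}_o\to\mathbf{FQSym}$, $\Theta(\mathbb{F})=\sum_{\sigma\in S_{\mathbb{F}}}\sigma$ with $S_{\mathbb{F}}=\{\sigma\in\Sigma_n:i\twoheadrightarrow j\Rightarrow\sigma^{ -1}(i)>\sigma^{ -1}(j)\}$, is a Hopf algebra morphism whose restriction to $\mathbf{H}_{ho}$ is an isomorphism onto $\mathbf{FQSym}$. For $\sigma\in\Sigma_n$, $\mathbb{T}^\sigma$ is the unique element of $\mathbf{H}_{ho}$ with $\Theta(\mathbb{T}^\sigma)=\sigma^{ -1}$; the product $\mathbb{T}^\sigma\mathbb{T}^\tau$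 lies in $\mathbf{H}_o(k+l)$, on which $\epsilon^{ -1}$ acts. -}

module Defs where

open import Level using (Level; _⊔_) renaming (suc to lsuc)
open import Data.Nat using (ℕ; zero; suc) renaming (_+_ to _+ℕ_)
open import Data.Fin using (Fin; toℕ; _<_; _↑ˡ_; _↑ʳ_; splitAt; join)
open import Data.Fin.Properties using (any?; all?; _<?_; +↔⊎) renaming (_≟_ to _≟ᶠ_)
open import Data.Fin.Permutation using (Permutation′; _⟨$⟩ʳ_; _⟨$⟩ˡ_; flip)
open import Data.Maybe using (Maybe; just; nothing; maybe′; map)
open import Data.Maybe.Properties using (≡-dec)
open import Data.Product using (Σ; ∃; _×_; _,_; proj₁; proj₂)
open import Data.Sum using (_⊎_; inj₁; inj₂; [_,_]′)
open import Data.Sum.Function.Propositional using (_⊎-↔_)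
open import Function.Construct.Composition using (_↔-∘_)
open import Function.Construct.Symmetry using (↔-sym)
open import Data.List using (List; []; _∷_; _++_; concatMap)
open import Data.List.Relation.Unary.All using (All)
open import Data.List.Relation.Unary.Any using (Any)
open import Data.List.Relation.Unary.AllPairs using (AllPairs)
open import Algebra.Bundles using (CommutativeRing)
open import Relation.Nullary using (¬_; Dec; yes; no; does; _→-dec_)
open import Relation.Binary.PropositionalEquality using (_≡_)
open import Data.Bool using (if_then_else_)

record Field (c ℓ : Level) : Set (lsuc (c ⊔ ℓ)) where
  field
    commutativeRing : CommutativeRing c ℓ
  open CommutativeRing commutativeRing public
  field
    0≉1     : ¬ (0# ≈ 1#)
    inverse : ∀ x → ¬ (x ≈ 0#) → ∃ λ y → (x * y) ≈ 1#

-- (σ ○ τ)(i) = σ(τ(i))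
_○_ : ∀ {n} → Permutation′ n → Permutation′ n → Permutation′ n
σ ○ τ = σ ↔-∘ τ

inv : ∀ {n} → Permutation′ n → Permutation′ n
inv = flip

_≈ₚ_ : ∀ {n} → Permutation′ n → Permutation′ n → Set
π ≈ₚ ρ = ∀ i → π ⟨$⟩ʳ i ≡ ρ ⟨$⟩ʳ i

_≈ₚ?_ : ∀ {n} (π ρ : Permutation′ n) → Dec (π ≈ₚ ρ)
π ≈ₚ? ρ = all? (λ i → (π ⟨$⟩ʳ i) ≟ᶠ (ρ ⟨$⟩ʳ i))

-- σ ⊗ τ : i ↦ σ(i) (i ≤ k),  k + j ↦ k + τ(j)
_⊗_ : ∀ {k l} → Permutation′ k → Permutation′ l → Permutation′ (k +ℕ l)
σ ⊗ τ = ↔-sym +↔⊎ ↔-∘ ((σ ⊎-↔ τ) ↔-∘ +↔⊎)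

-- Sh(k,l): ζ⁻¹(1) < … < ζ⁻¹(k) and ζ⁻¹(k+1) < … < ζ⁻¹(k+l)
IsShuffle : ∀ k l → Permutation′ (k +ℕ l) → Set
IsShuffle k l ζ =
  (∀ (i j : Fin k) → i < j →
      (ζ ⟨$⟩ˡ (i ↑ˡ l)) < (ζ ⟨$⟩ˡ (j ↑ˡ l))) ×
  (∀ (i j : Fin l) → i < j →
      (ζ ⟨$⟩ˡ (k ↑ʳ i)) < (ζ ⟨$⟩ˡ (k ↑ʳ j)))

EnumeratesShuffles : ∀ k l → List (Permutation′ (k +ℕ l)) → Set
EnumeratesShuffles k l L =
  (∀ ζ → IsShuffle k l ζ → Any (ζ ≈ₚ_) L) ×
  All (IsShuffle k l) L ×
  AllPairs (λ a b → ¬ (a ≈ₚ b)) L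

-- Forests on the vertex set Fin n, given by their parent map
-- (nothing = root).  Edges point towards the roots.

Parent : ℕ → Set
Parent n = Fin n → Maybe (Fin n)

iter : ∀ {n} → Parent n → ℕ → Fin n → Maybe (Fin n)
iter p zero    i = just i
iter p (suc m) i = maybe′ (iter p m) nothing (p i)

-- i ↠ j : there is an oriented path (of length ≥ 1) from i to j.
-- In a functional graph on n vertices a shortest path has length ≤ n,
-- so paths of length 1 … n suffice.
Reach : ∀ {n} → Parent n → Fin n → Fin n → Set
Reach {n} p i j = ∃ λ (m : Fin n) → iter p (suc (toℕ m)) i ≡ just j

Reach? : ∀ {n} (p : Parent n) i j → Dec (Reach p i j)
Reach? p i j = any? (λ m → ≡-dec _≟ᶠ_ (iter p (suc (toℕ m)) i) (just j))

IsForest : ∀ {n} → Parent n → Set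
IsForest p = ∀ i → ¬ Reach p i i

HeapOrdered : ∀ {n} → Parent n → Set
HeapOrdered p = IsForest p × (∀ i j → Reach p i j → j < i)

_≟ₚ_ : ∀ {n} (p q : Parent n) → Dec (∀ i → p i ≡ q i)
p ≟ₚ q = all? (λ i → ≡-dec _≟ᶠ_ (p i) (q i))

_·ᶠ_ : ∀ {k l} → Parent k → Parent l → Parent (k +ℕ l)
_·ᶠ_ {k} {l} p q i =
  [ (λ a → map (_↑ˡ l) (p a)) , (λ b → map (k ↑ʳ_) (q b)) ]′ (splitAt k i)

-- σ.F : the vertex labelled i is relabelled σ(i)
act : ∀ {n} → Permutation′ n → Parent n → Parent n
act σ p j = map (σ ⟨$⟩ʳ_) (p (σ ⟨$⟩ˡ j))

InS : ∀ {n} → Parent n → Permutation′ n → Set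
InS p σ = ∀ i j → Reach p i j → (σ ⟨$⟩ˡ j) < (σ ⟨$⟩ˡ i)

InS? : ∀ {n} (p : Parent n) σ → Dec (InS p σ)
InS? p σ = all? (λ i → all? (λ j → Reach? p i j →-dec ((σ ⟨$⟩ˡ j) <? (σ ⟨$⟩ˡ i))))

module Lin {c ℓ} (K : Field c ℓ) where
  open Field K hiding (inverse)

  -- an element of H_o(n) given as a formal linear combination of forests
  Comb : ℕ → Set c
  Comb n = List (Carrier × Parent n)

  InHho : ∀ {n} → Comb n → Set c
  InHho v = All (λ e → HeapOrdered (proj₂ e)) v

  coeff : ∀ {n} → Comb n → Parent n → Carrier
  coeff []            p = 0#
  coeff ((a , q) ∷ v) p = (if does (q ≟ₚ p) then a else 0#) + coeff v p

  _≋_ : ∀ {n} → Comb n → Comb n → Set ℓ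
  v ≋ w = ∀ p → coeff v p ≈ coeff w p

  _·_ : ∀ {k l} → Comb k → Comb l → Comb (k +ℕ l)
  v · w = concatMap (λ e → concatMap (λ f →
            ((proj₁ e * proj₁ f) , (proj₂ e ·ᶠ proj₂ f)) ∷ []) w) v

  _∙_ : ∀ {n} → Permutation′ n → Comb n → Comb n
  σ ∙ v = Data.List.map (λ e → proj₁ e , act σ (proj₂ e)) v

  ∑ : ∀ {A : Set} {n} → List A → (A → Comb n) → Comb n
  ∑ L f = concatMap f L

  -- coefficient of the permutation π in Θ(v)
  Θcoeff : ∀ {n} → Comb n → Permutation′ n → Carrier
  Θcoeff []            π = 0#
  Θcoeff ((a , q) ∷ v) π = (if does (InS? q π) then a else 0#) + Θcoeff v π

  -- Θ(v) = ρ  (ρ a basis element of FQSym)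
  ΘIs : ∀ {n} → Comb n → Permutation′ n → Set ℓ
  ΘIs v ρ = ∀ π → Θcoeff v π ≈ (if does (π ≈ₚ? ρ) then 1# else 0#)

  -- T is the map σ ↦ 𝕋^σ : 𝕋^σ ∈ H_ho and Θ(𝕋^σ) = σ⁻¹
  IsT : (∀ {n} → Permutation′ n → Comb n) → Set (c ⊔ ℓ)
  IsT T = ∀ {n} (σ : Permutation′ n) → InHho (T σ) × ΘIs (T σ) (inv σ)

module Submission where

-- Both sides lie in H_ho and Θ is injective on H_ho, so it suffices to compare their
-- images under Θ at every permutation π.  On the left, Θ(ε⁻¹.(v w))(π) = Θ(v)(π₁) Θ(w)(π₂),
-- where π₁ and π₂ standardize π⁻¹ ∘ ε⁻¹ on the two blocks of Fin (k + l); since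
-- Θ(𝕋^σ) = σ⁻¹ this is [π₁ = σ⁻¹][π₂ = τ⁻¹].  On the right one gets the number of
-- shuffles ζ with π = (ζ⁻¹ ∘ (σ ⊗ τ) ∘ ε)⁻¹, which is 1 when π₁ = σ⁻¹ and π₂ = τ⁻¹ and 0
-- otherwise.

open import Defs
open import Data.Nat using (ℕ) renaming (_+_ to _+ℕ_)
open import Data.List using (List)
open import Data.Fin.Permutation using (Permutation′)

open import Level using (Level)
open import Data.Nat
  using (zero; suc; z≤n; s≤s; s≤s⁻¹; _≤_; _<_; _≤?_; _<?_; _≟_; _<ᵇ_) renaming (_*_ to _*ℕ_)
import Data.Nat.Properties as ℕₚ
open import Data.Fin as Fin using (Fin; toℕ; fromℕ<; punchOut; _↑ˡ_; _↑ʳ_; splitAt)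
import Data.Fin.Properties as Finₚ
open import Data.Fin.Permutation using (_⟨$⟩ʳ_; _⟨$⟩ˡ_; permutation; inverseˡ; inverseʳ)
open import Data.Bool using (Bool; true; false; T; if_then_else_; _∧_)
open import Data.Unit using (tt)
open import Data.Maybe as Maybe using (Maybe; just; nothing; maybe′)
open import Data.Maybe.Properties using (just-injective; map-injective)
open import Data.List as List using ([]; _∷_; _++_; length; filter; concatMap)
import Data.List.Properties as Listₚ
open import Data.List.Extrema.Nat using (argmin; argmin-sel; argmin-all; f[argmin]≤f[⊤]; f[argmin]≤f[xs])
open import Data.List.Relation.Unary.All as All using (All; []; _∷_)
import Data.List.Relation.Unary.All.Properties as Allₚ
open import Data.List.Relation.Unary.Any as Any using (Any; here; there)
open import Data.List.Relation.Unary.AllPairs using (AllPairs; _∷_)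
open import Data.Product using (Σ; ∃; _×_; _,_; proj₁; proj₂)
open import Data.Sum using (_⊎_; inj₁; inj₂)
open import Data.Empty using (⊥; ⊥-elim)
open import Function using (_∘_)
open import Function.Definitions using (Injective)
open import Relation.Nullary using (¬_; Dec; yes; no; does; ¬?; _×-dec_)
open import Relation.Nullary.Decidable using (dec-true; dec-false; does-⇔)
open import Function.Bundles using (mk⇔)
open import Relation.Binary.Definitions using (tri<; tri≈; tri>)
open import Relation.Binary.PropositionalEquality
  using (_≡_; _≢_; refl; sym; trans; cong; cong₂; subst; subst₂; module ≡-Reasoning)
open import Algebra.Properties.CommutativeMonoid.Sum ℕₚ.+-0-commutativeMonoid using (sum; sum-permute)

-- Pigeonhole: an injective endomap of Fin n is onto, since otherwise punching the
-- missed value out of its range would inject Fin n into Fin (n - 1).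
injective⇒onto : ∀ {n} (f : Fin n → Fin n) → Injective _≡_ _≡_ f → ∀ y → ∃ λ x → f x ≡ y
injective⇒onto f inj y with Finₚ.any? (λ x → f x Finₚ.≟ y)
... | yes found = found
injective⇒onto {suc n} f inj y | no missed =
  ⊥-elim (ℕₚ.<-irrefl refl (Finₚ.injective⇒≤ squeeze-injective))
  where
  squeeze : Fin (suc n) → Fin n
  squeeze x = punchOut {i = y} {j = f x} (λ e → missed (x , sym e))

  squeeze-injective : Injective _≡_ _≡_ squeeze
  squeeze-injective {a} {b} =
    inj ∘ Finₚ.punchOut-injective (λ e → missed (a , sym e)) (λ e → missed (b , sym e))

injection⇒permutation : ∀ {n} (f : Fin n → Fin n) → Injective _≡_ _≡_ f →
  Σ (Permutation′ n) λ π → ∀ i → π ⟨$⟩ˡ i ≡ f i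
injection⇒permutation f inj =
  permutation preimage f (λ x → inj (proj₂ (onto (f x)))) (λ y → proj₂ (onto y)) , λ _ → refl
  where
  onto : ∀ y → ∃ λ x → f x ≡ y
  onto = injective⇒onto f inj

  preimage : Fin _ → Fin _
  preimage y = proj₁ (onto y)

module _ {n : ℕ} where

  ≈ₚ-inverse : {π ρ : Permutation′ n} → π ≈ₚ ρ → ∀ x → π ⟨$⟩ˡ x ≡ ρ ⟨$⟩ˡ x
  ≈ₚ-inverse {π} {ρ} π≈ρ x = begin
    π ⟨$⟩ˡ x                    ≡⟨ cong (π ⟨$⟩ˡ_) (sym (inverseʳ ρ)) ⟩
    π ⟨$⟩ˡ (ρ ⟨$⟩ʳ (ρ ⟨$⟩ˡ x))   ≡⟨ cong (π ⟨$⟩ˡ_) (sym (π≈ρ (ρ ⟨$⟩ˡ x))) ⟩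
    π ⟨$⟩ˡ (π ⟨$⟩ʳ (ρ ⟨$⟩ˡ x))   ≡⟨ inverseˡ π ⟩
    ρ ⟨$⟩ˡ x                    ∎
    where open ≡-Reasoning

  ≈ₚ-fromInverse : {π ρ : Permutation′ n} → (∀ x → π ⟨$⟩ˡ x ≡ ρ ⟨$⟩ˡ x) → π ≈ₚ ρ
  ≈ₚ-fromInverse {π} {ρ} = ≈ₚ-inverse {inv π} {inv ρ}

  inverse-injective : (π : Permutation′ n) → Injective _≡_ _≡_ (π ⟨$⟩ˡ_)
  inverse-injective π {x} {y} e = trans (sym (inverseʳ π)) (trans (cong (π ⟨$⟩ʳ_) e) (inverseʳ π))

module _ {k l : ℕ} (σ : Permutation′ k) (τ : Permutation′ l) where

  ⊗-left : ∀ a → (σ ⊗ τ) ⟨$⟩ʳ (a ↑ˡ l) ≡ (σ ⟨$⟩ʳ a) ↑ˡ l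
  ⊗-left a rewrite Finₚ.splitAt-↑ˡ k a l = refl

  ⊗-left⁻¹ : ∀ a → (σ ⊗ τ) ⟨$⟩ˡ (a ↑ˡ l) ≡ (σ ⟨$⟩ˡ a) ↑ˡ l
  ⊗-left⁻¹ a rewrite Finₚ.splitAt-↑ˡ k a l = refl

  ⊗-right : ∀ b → (σ ⊗ τ) ⟨$⟩ʳ (k ↑ʳ b) ≡ k ↑ʳ (τ ⟨$⟩ʳ b)
  ⊗-right b rewrite Finₚ.splitAt-↑ʳ k l b = refl

  ⊗-right⁻¹ : ∀ b → (σ ⊗ τ) ⟨$⟩ˡ (k ↑ʳ b) ≡ k ↑ʳ (τ ⟨$⟩ˡ b)
  ⊗-right⁻¹ b rewrite Finₚ.splitAt-↑ʳ k l b = refl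

indicator : Bool → ℕ
indicator true  = 1
indicator false = 0

count : ∀ {k} → (Fin k → Bool) → ℕ
count f = sum (indicator ∘ f)

indicator-mono : ∀ a b → (T a → T b) → indicator a ≤ indicator b
indicator-mono false b     _ = z≤n
indicator-mono true  true  _ = ℕₚ.≤-refl
indicator-mono true  false h = ⊥-elim (h tt)

indicator-strict : ∀ a b → ¬ T a → T b → indicator a < indicator b
indicator-strict false true  _  _  = s≤s z≤n
indicator-strict true  _     ¬a _  = ⊥-elim (¬a tt)
indicator-strict false false _  ()

count-mono : ∀ {k} (f g : Fin k → Bool) → (∀ x → T (f x) → T (g x)) → count f ≤ count g
count-mono {zero}  f g f⊆g = z≤n
count-mono {suc k} f g f⊆g =
  ℕₚ.+-mono-≤ (indicator-mono (f Fin.zero) (g Fin.zero) (f⊆g Fin.zero))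
              (count-mono (f ∘ Fin.suc) (g ∘ Fin.suc) (f⊆g ∘ Fin.suc))

count-strict : ∀ {k} (f g : Fin k → Bool) → (∀ x → T (f x) → T (g x)) →
  ∀ x → ¬ T (f x) → T (g x) → count f < count g
count-strict f g f⊆g Fin.zero ¬fx gx =
  ℕₚ.+-mono-<-≤ (indicator-strict (f Fin.zero) (g Fin.zero) ¬fx gx)
                (count-mono (f ∘ Fin.suc) (g ∘ Fin.suc) (f⊆g ∘ Fin.suc))
count-strict f g f⊆g (Fin.suc x) ¬fx gx =
  ℕₚ.+-mono-≤-< (indicator-mono (f Fin.zero) (g Fin.zero) (f⊆g Fin.zero))
                (count-strict (f ∘ Fin.suc) (g ∘ Fin.suc) (f⊆g ∘ Fin.suc) x ¬fx gx)

count-all : ∀ k → count {k} (λ _ → true) ≡ k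
count-all zero    = refl
count-all (suc k) = cong suc (count-all k)

count-none : ∀ k → count {k} (λ _ → false) ≡ 0
count-none zero    = refl
count-none (suc k) = count-none k

count-cong : ∀ {k} {f g : Fin k → Bool} → (∀ x → f x ≡ g x) → count f ≡ count g
count-cong {zero}  f≗g = refl
count-cong {suc k} f≗g = cong₂ _+ℕ_ (cong indicator (f≗g Fin.zero)) (count-cong (f≗g ∘ Fin.suc))

count-below : ∀ {k} (c : Fin k) → count {k} (λ x → toℕ x <ᵇ toℕ c) ≡ toℕ c
count-below {suc k} Fin.zero    = count-none k
count-below {suc k} (Fin.suc c) = cong suc (count-below c)

count-permute : ∀ {k} (f : Fin k → Bool) (π : Permutation′ k) → count (f ∘ (π ⟨$⟩ʳ_)) ≡ count f
count-permute f π = sym (sum-permute (indicator ∘ f) π)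

<ᵇ-cong : ∀ {x y x′ y′} → (x < y → x′ < y′) → (x′ < y′ → x < y) → (x <ᵇ y) ≡ (x′ <ᵇ y′)
<ᵇ-cong {x} {y} {x′} {y′} to from with x <ᵇ y in e | x′ <ᵇ y′ in e′
... | true  | true  = refl
... | false | false = refl
... | true  | false = ⊥-elim (subst T e′ (ℕₚ.<⇒<ᵇ (to (ℕₚ.<ᵇ⇒< x y (subst T (sym e) tt)))))
... | false | true  = ⊥-elim (subst T e (ℕₚ.<⇒<ᵇ (from (ℕₚ.<ᵇ⇒< x′ y′ (subst T (sym e′) tt)))))

increasing-reflects : ∀ {a b} (f : Fin a → Fin b) → (∀ i j → i Fin.< j → f i Fin.< f j) →
  ∀ i j → f i Fin.< f j → i Fin.< j
increasing-reflects f increasing i j fi<fj with ℕₚ.<-cmp (toℕ i) (toℕ j)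
... | tri< i<j _ _ = i<j
... | tri≈ _ i≡j _ = ⊥-elim (ℕₚ.<-irrefl (cong (toℕ ∘ f) (Finₚ.toℕ-injective i≡j)) fi<fj)
... | tri> _ _ j<i = ⊥-elim (ℕₚ.<-asym fi<fj (increasing j i j<i))

-- The standardization of an injection g : Fin k → Fin N is the permutation of Fin k
-- whose inverse lists the values of g in increasing order: its inverse sends i to
-- the rank of g i, the number of j with g j < g i.
module Standardization {k N : ℕ} (g : Fin k → Fin N) where

  rank : Fin k → ℕ
  rank i = count (λ j → toℕ (g j) <ᵇ toℕ (g i))

  rank<k : ∀ i → rank i < k
  rank<k i = subst (rank i <_) (count-all k)
    (count-strict _ _ (λ _ _ → tt) i (λ t → ℕₚ.<-irrefl refl (ℕₚ.<ᵇ⇒< (toℕ (g i)) (toℕ (g i)) t)) tt)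

  rank-mono : ∀ i j → g i Fin.< g j → rank i < rank j
  rank-mono i j gi<gj =
    count-strict _ _ (λ x t → ℕₚ.<⇒<ᵇ (ℕₚ.<-trans (ℕₚ.<ᵇ⇒< _ _ t) gi<gj)) i
      (λ t → ℕₚ.<-irrefl refl (ℕₚ.<ᵇ⇒< (toℕ (g i)) (toℕ (g i)) t)) (ℕₚ.<⇒<ᵇ gi<gj)

  module _ (g-injective : Injective _≡_ _≡_ g) where

    rank-reflect : ∀ i j → rank i < rank j → g i Fin.< g j
    rank-reflect i j ri<rj with ℕₚ.<-cmp (toℕ (g i)) (toℕ (g j))
    ... | tri< gi<gj _ _ = gi<gj
    ... | tri≈ _ gi≡gj _ = ⊥-elim (ℕₚ.<-irrefl (cong rank (g-injective (Finₚ.toℕ-injective gi≡gj))) ri<rj)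
    ... | tri> _ _ gj<gi = ⊥-elim (ℕₚ.<-asym ri<rj (rank-mono j i gj<gi))

    rank-injective : ∀ i j → rank i ≡ rank j → i ≡ j
    rank-injective i j ri≡rj with ℕₚ.<-cmp (toℕ (g i)) (toℕ (g j))
    ... | tri< gi<gj _ _ = ⊥-elim (ℕₚ.<-irrefl ri≡rj (rank-mono i j gi<gj))
    ... | tri≈ _ gi≡gj _ = g-injective (Finₚ.toℕ-injective gi≡gj)
    ... | tri> _ _ gj<gi = ⊥-elim (ℕₚ.<-irrefl (sym ri≡rj) (rank-mono j i gj<gi))

    private
      rankᶠ : Fin k → Fin k
      rankᶠ i = fromℕ< (rank<k i)

      rankᶠ-injective : Injective _≡_ _≡_ rankᶠ
      rankᶠ-injective {i} {j} e = rank-injective i j (begin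
        rank i            ≡⟨ sym (Finₚ.toℕ-fromℕ< (rank<k i)) ⟩
        toℕ (rankᶠ i)     ≡⟨ cong toℕ e ⟩
        toℕ (rankᶠ j)     ≡⟨ Finₚ.toℕ-fromℕ< (rank<k j) ⟩
        rank j            ∎)
        where open ≡-Reasoning

    std : Permutation′ k
    std = proj₁ (injection⇒permutation rankᶠ rankᶠ-injective)

    std⁻¹≡rank : ∀ i → toℕ (std ⟨$⟩ˡ i) ≡ rank i
    std⁻¹≡rank i = trans (cong toℕ (proj₂ (injection⇒permutation rankᶠ rankᶠ-injective) i))
                         (Finₚ.toℕ-fromℕ< (rank<k i))

    std-preserves : ∀ i j → g i Fin.< g j → std ⟨$⟩ˡ i Fin.< std ⟨$⟩ˡ j
    std-preserves i j gi<gj = subst₂ _<_ (sym (std⁻¹≡rank i)) (sym (std⁻¹≡rank j)) (rank-mono i j gi<gj)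

    std-reflects : ∀ i j → std ⟨$⟩ˡ i Fin.< std ⟨$⟩ˡ j → g i Fin.< g j
    std-reflects i j lt = rank-reflect i j (subst₂ _<_ (std⁻¹≡rank i) (std⁻¹≡rank j) lt)

    std-of-order-copy : (σ : Permutation′ k) →
      (∀ i j → g i Fin.< g j → σ ⟨$⟩ʳ i Fin.< σ ⟨$⟩ʳ j) →
      (∀ i j → σ ⟨$⟩ʳ i Fin.< σ ⟨$⟩ʳ j → g i Fin.< g j) → std ≈ₚ inv σ
    std-of-order-copy σ to from = ≈ₚ-fromInverse {π = std} {ρ = inv σ} λ i → Finₚ.toℕ-injective (begin
      toℕ (std ⟨$⟩ˡ i)                                   ≡⟨ std⁻¹≡rank i ⟩
      count (λ j → toℕ (g j) <ᵇ toℕ (g i))               ≡⟨ count-cong (λ j → <ᵇ-cong (to j i) (from j i)) ⟩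
      count (λ j → toℕ (σ ⟨$⟩ʳ j) <ᵇ toℕ (σ ⟨$⟩ʳ i))
        ≡⟨ count-permute (λ x → toℕ x <ᵇ toℕ (σ ⟨$⟩ʳ i)) σ ⟩
      count {k} (λ x → toℕ x <ᵇ toℕ (σ ⟨$⟩ʳ i))          ≡⟨ count-below (σ ⟨$⟩ʳ i) ⟩
      toℕ (σ ⟨$⟩ʳ i)                                     ∎)
      where open ≡-Reasoning

    std-of-increasing∘ : (σ : Permutation′ k) (f : Fin k → Fin N) → (∀ i j → i Fin.< j → f i Fin.< f j) →
      (∀ j → g j ≡ f (σ ⟨$⟩ʳ j)) → std ≈ₚ inv σ
    std-of-increasing∘ σ f increasing g≡f∘σ = std-of-order-copy σ
      (λ i j gi<gj → increasing-reflects f increasing _ _ (subst₂ Fin._<_ (g≡f∘σ i) (g≡f∘σ j) gi<gj))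
      (λ i j σi<σj → subst₂ Fin._<_ (sym (g≡f∘σ i)) (sym (g≡f∘σ j)) (increasing _ _ σi<σj))

    std-inverse-increasing : (σ : Permutation′ k) → std ≈ₚ inv σ →
      ∀ i j → i Fin.< j → g (σ ⟨$⟩ˡ i) Fin.< g (σ ⟨$⟩ˡ j)
    std-inverse-increasing σ std≈σ⁻¹ i j i<j =
      std-reflects _ _ (subst₂ Fin._<_ (sym (σσ⁻¹ i)) (sym (σσ⁻¹ j)) i<j)
      where
      σσ⁻¹ : ∀ x → std ⟨$⟩ˡ (σ ⟨$⟩ˡ x) ≡ x
      σσ⁻¹ x = trans (≈ₚ-inverse {π = std} {ρ = inv σ} std≈σ⁻¹ (σ ⟨$⟩ˡ x)) (inverseʳ σ)

-- Inserting a new entry at slot t of a sequence moves the entry at position x to shift t x.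
shift : ℕ → ℕ → ℕ
shift t x with t ≤? x
... | yes _ = suc x
... | no  _ = x

shift-≤ : ∀ t x → shift t x ≤ suc x
shift-≤ t x with t ≤? x
... | yes _ = ℕₚ.≤-refl
... | no  _ = ℕₚ.n≤1+n x

shift-≢ : ∀ t x → shift t x ≢ t
shift-≢ t x e with t ≤? x
... | yes t≤x = ℕₚ.<-irrefl (sym e) (s≤s t≤x)
... | no  t≰x = t≰x (ℕₚ.≤-reflexive (sym e))

shift-fixes : ∀ {t x} → x < t → shift t x ≡ x
shift-fixes {t} {x} x<t with t ≤? x
... | yes t≤x = ⊥-elim (ℕₚ.<-irrefl refl (ℕₚ.<-≤-trans x<t t≤x))
... | no  _   = refl

shift-below : ∀ t x → shift t x < t → x < t
shift-below t x lt with t ≤? x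
... | yes t≤x = ⊥-elim (ℕₚ.<-asym lt (s≤s t≤x))
... | no  _   = lt

shift-mono : ∀ t {x y} → x < y → shift t x < shift t y
shift-mono t {x} {y} x<y with t ≤? x | t ≤? y
... | yes _   | yes _   = s≤s x<y
... | yes t≤x | no  t≰y = ⊥-elim (t≰y (ℕₚ.≤-trans t≤x (ℕₚ.<⇒≤ x<y)))
... | no  _   | yes _   = ℕₚ.m<n⇒m<1+n x<y
... | no  _   | no  _   = x<y

shift-reflect : ∀ t {x y} → shift t x < shift t y → x < y
shift-reflect t {x} {y} lt with ℕₚ.<-cmp x y
... | tri< x<y _ _ = x<y
... | tri≈ _ refl _ = ⊥-elim (ℕₚ.<-irrefl refl lt)
... | tri> _ _ y<x = ⊥-elim (ℕₚ.<-asym lt (shift-mono t y<x))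

shift-injective : ∀ t {x y} → shift t x ≡ shift t y → x ≡ y
shift-injective t {x} {y} e with ℕₚ.<-cmp x y
... | tri< x<y _ _ = ⊥-elim (ℕₚ.<-irrefl e (shift-mono t x<y))
... | tri≈ _ x≡y _ = x≡y
... | tri> _ _ y<x = ⊥-elim (ℕₚ.<-irrefl (sym e) (shift-mono t y<x))

HeapParent : (ℕ → Maybe ℕ) → Set
HeapParent parent = ∀ m a → parent m ≡ just a → a < m

-- Insert the vertices 0, 1, 2, … one at a time into a sequence: vertex m goes to the
-- slot just after its parent, or to the front if it is a root.  pos m j is the position
-- of vertex j < m once 0 … m-1 have been inserted, slot m the slot of vertex m, and
-- code m encodes slot 0, …, slot (m-1) (with slot i ≤ i) as a mixed-radix number.
module Insertion (parent : ℕ → Maybe ℕ) where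

  mutual
    pos : ℕ → ℕ → ℕ
    pos zero    j = 0
    pos (suc m) j with j ≟ m
    ... | yes _ = slot m
    ... | no  _ = shift (slot m) (pos m j)

    slot : ℕ → ℕ
    slot m = maybe′ (λ a → suc (pos m a)) 0 (parent m)

  code : ℕ → ℕ
  code zero    = 0
  code (suc m) = code m *ℕ suc m +ℕ slot m

  pos-new : ∀ m → pos (suc m) m ≡ slot m
  pos-new m with m ≟ m
  ... | yes _   = refl
  ... | no  m≢m = ⊥-elim (m≢m refl)

  pos-old : ∀ m {j} → j ≢ m → pos (suc m) j ≡ shift (slot m) (pos m j)
  pos-old m {j} j≢m with j ≟ m
  ... | yes j≡m = ⊥-elim (j≢m j≡m)
  ... | no  _   = refl

  slot-child : ∀ m {a} → parent m ≡ just a → slot m ≡ suc (pos m a)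
  slot-child m e rewrite e = refl

  module _ (heap : HeapParent parent) where

    mutual
      pos<m : ∀ m j → j < m → pos m j < m
      pos<m (suc m) j j<1+m with j ≟ m
      ... | yes _   = s≤s (slot≤m m)
      ... | no  j≢m = s≤s (ℕₚ.≤-trans (shift-≤ (slot m) (pos m j))
                                      (pos<m m j (ℕₚ.≤∧≢⇒< (s≤s⁻¹ j<1+m) j≢m)))

      slot≤m : ∀ m → slot m ≤ m
      slot≤m m with parent m in e
      ... | just a  = pos<m m a (heap m a e)
      ... | nothing = z≤n

    pos-injective : ∀ m {j j′} → j < m → j′ < m → pos m j ≡ pos m j′ → j ≡ j′
    pos-injective (suc m) {j} {j′} j<1+m j′<1+m e with j ≟ m | j′ ≟ m
    ... | yes j≡m | yes j′≡m = trans j≡m (sym j′≡m)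
    ... | yes _   | no  _    = ⊥-elim (shift-≢ (slot m) (pos m j′) (sym e))
    ... | no  _   | yes _    = ⊥-elim (shift-≢ (slot m) (pos m j) e)
    ... | no  j≢m | no  j′≢m = pos-injective m (ℕₚ.≤∧≢⇒< (s≤s⁻¹ j<1+m) j≢m)
                                 (ℕₚ.≤∧≢⇒< (s≤s⁻¹ j′<1+m) j′≢m) (shift-injective (slot m) e)

    private
      pos-after : ∀ {m m′ j} → m ≤ m′ → j < m → pos (suc m′) j ≡ shift (slot m′) (pos m′ j)
      pos-after m≤m′ j<m = pos-old _ (λ j≡m′ → ℕₚ.<-irrefl j≡m′ (ℕₚ.<-≤-trans j<m m≤m′))

    pos-preserved : ∀ {m m′ j j′} → m ≤ m′ → j < m → j′ < m →
      pos m j < pos m j′ → pos m′ j < pos m′ j′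
    pos-preserved m≤m′ j<m j′<m lt with ℕₚ.m≤n⇒m<n∨m≡n m≤m′
    ... | inj₂ refl = lt
    pos-preserved {m′ = suc m″} _ j<m j′<m lt | inj₁ (s≤s m≤m″) =
      subst₂ _<_ (sym (pos-after m≤m″ j<m)) (sym (pos-after m≤m″ j′<m))
        (shift-mono (slot m″) (pos-preserved m≤m″ j<m j′<m lt))

    pos-reflected : ∀ {m m′ j j′} → m ≤ m′ → j < m → j′ < m →
      pos m′ j < pos m′ j′ → pos m j < pos m j′
    pos-reflected m≤m′ j<m j′<m lt with ℕₚ.m≤n⇒m<n∨m≡n m≤m′
    ... | inj₂ refl = lt
    pos-reflected {m′ = suc m″} _ j<m j′<m lt | inj₁ (s≤s m≤m″) =
      pos-reflected m≤m″ j<m j′<m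
        (shift-reflect (slot m″) (subst₂ _<_ (pos-after m≤m″ j<m) (pos-after m≤m″ j′<m) lt))

    parent-before : ∀ n m {a} → m < n → parent m ≡ just a → pos n a < pos n m
    parent-before n m {a} m<n e = pos-preserved m<n (ℕₚ.m<n⇒m<1+n a<m) ℕₚ.≤-refl just-inserted
      where
      a<m : a < m
      a<m = heap m a e

      just-inserted : pos (suc m) a < pos (suc m) m
      just-inserted = subst₂ _<_
        (sym (trans (pos-old m (λ a≡m → ℕₚ.<-irrefl a≡m a<m))
                    (shift-fixes (ℕₚ.≤-reflexive (sym (slot-child m e))))))
        (sym (trans (pos-new m) (slot-child m e))) ℕₚ.≤-refl

AgreeBelow : (ℕ → Maybe ℕ) → (ℕ → Maybe ℕ) → ℕ → Set
AgreeBelow parent parent′ m = ∀ i → i < m → parent i ≡ parent′ i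

agreeBelow-pred : ∀ {parent parent′ m} → AgreeBelow parent parent′ (suc m) → AgreeBelow parent parent′ m
agreeBelow-pred agree i i<m = agree i (ℕₚ.m<n⇒m<1+n i<m)

agreeBelow-suc : ∀ {parent parent′ m} → AgreeBelow parent parent′ m → parent m ≡ parent′ m →
  AgreeBelow parent parent′ (suc m)
agreeBelow-suc agree e i i<1+m with ℕₚ.m≤n⇒m<n∨m≡n (s≤s⁻¹ i<1+m)
... | inj₁ i<m  = agree i i<m
... | inj₂ refl = e

module Locality (parent parent′ : ℕ → Maybe ℕ) where
  private
    module I  = Insertion parent
    module I′ = Insertion parent′

  mutual
    pos-local : ∀ m → AgreeBelow parent parent′ m → ∀ j → I.pos m j ≡ I′.pos m j
    pos-local zero    agree j = refl
    pos-local (suc m) agree j with j ≟ m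
    ... | yes _ = slot-local m agree
    ... | no  _ = cong₂ shift (slot-local m agree) (pos-local m (agreeBelow-pred agree) j)

    slot-local : ∀ m → AgreeBelow parent parent′ (suc m) → I.slot m ≡ I′.slot m
    slot-local m agree with parent m | parent′ m | agree m ℕₚ.≤-refl
    ... | just a  | just .a  | refl = cong suc (pos-local m (agreeBelow-pred agree) a)
    ... | nothing | nothing  | refl = refl

  code-local : ∀ m → AgreeBelow parent parent′ m → I.code m ≡ I′.code m
  code-local zero    agree = refl
  code-local (suc m) agree =
    cong₂ _+ℕ_ (cong (_*ℕ suc m) (code-local m (agreeBelow-pred agree))) (slot-local m agree)

radix-<-last : ∀ {x x′ y y′} s → x′ ≡ x → y′ < y → x′ *ℕ s +ℕ y′ < x *ℕ s +ℕ y
radix-<-last {x} s refl y′<y = ℕₚ.+-monoʳ-< (x *ℕ s) y′<y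

radix-<-prefix : ∀ {x x′ y y′} m → x′ < x → y′ ≤ m → x′ *ℕ suc m +ℕ y′ < x *ℕ suc m +ℕ y
radix-<-prefix {x} {x′} {y} {y′} m x′<x y′≤m = begin-strict
  x′ *ℕ suc m +ℕ y′     ≤⟨ ℕₚ.+-monoʳ-≤ (x′ *ℕ suc m) y′≤m ⟩
  x′ *ℕ suc m +ℕ m      <⟨ ℕₚ.+-monoʳ-< (x′ *ℕ suc m) (ℕₚ.n<1+n m) ⟩
  x′ *ℕ suc m +ℕ suc m  ≡⟨ ℕₚ.+-comm (x′ *ℕ suc m) (suc m) ⟩
  suc x′ *ℕ suc m       ≤⟨ ℕₚ.*-monoˡ-≤ (suc m) x′<x ⟩
  x *ℕ suc m            ≤⟨ ℕₚ.m≤m+n (x *ℕ suc m) y ⟩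
  x *ℕ suc m +ℕ y       ∎
  where open ℕₚ.≤-Reasoning

module Triangularity (F G : ℕ → Maybe ℕ) (heapF : HeapParent F) (heapG : HeapParent G) (n : ℕ)
  (compatible : ∀ m a → m < n → G m ≡ just a → Insertion.pos F n a < Insertion.pos F n m) where
  private
    module IF = Insertion F
    module IG = Insertion G

  slot-compare : ∀ m → m < n → AgreeBelow G F m → G m ≡ F m ⊎ IG.slot m < IF.slot m
  slot-compare m m<n agree with G m in eG
  ... | nothing with F m
  ...   | nothing = inj₁ refl
  ...   | just _  = inj₂ (s≤s z≤n)
  slot-compare m m<n agree | just a = compare-with-parent
    where
    a<m : a < m
    a<m = heapG m a eG

    -- G's parent of m precedes m in F's sequence, hence lies before F's slot for m.
    before-slot : IF.pos m a < IF.slot m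
    before-slot = shift-below _ _ (subst₂ _<_ (IF.pos-old m (λ a≡m → ℕₚ.<-irrefl a≡m a<m)) (IF.pos-new m)
      (IF.pos-reflected heapF m<n (ℕₚ.m<n⇒m<1+n a<m) ℕₚ.≤-refl (compatible m a m<n eG)))

    same-pos : IG.pos m a ≡ IF.pos m a
    same-pos = Locality.pos-local G F m agree a

    compare-with-parent : just a ≡ F m ⊎ suc (IG.pos m a) < IF.slot m
    compare-with-parent with ℕₚ.m≤n⇒m<n∨m≡n before-slot
    ... | inj₁ lt = inj₂ (subst (λ z → suc z < IF.slot m) (sym same-pos) lt)
    ... | inj₂ eq with F m in eF
    ...   | nothing = ⊥-elim (ℕₚ.1+n≢0 eq)
    ...   | just b  = inj₁ (cong just (IF.pos-injective heapF m a<m (heapF m b eF) (ℕₚ.suc-injective eq)))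

  code-compare : ∀ m → m ≤ n → AgreeBelow G F m ⊎ IG.code m < IF.code m
  code-compare zero    _     = inj₁ (λ _ ())
  code-compare (suc m) 1+m≤n with code-compare m (ℕₚ.<⇒≤ 1+m≤n)
  ... | inj₂ lt    = inj₂ (radix-<-prefix m lt (IG.slot≤m heapG m))
  ... | inj₁ agree with slot-compare m 1+m≤n agree
  ...   | inj₁ same = inj₁ (agreeBelow-suc agree same)
  ...   | inj₂ lt   = inj₂ (radix-<-last (suc m) (Locality.code-local G F m agree) lt)

map-just⁻¹ : ∀ {A B : Set} (f : A → B) (mx : Maybe A) {y} → Maybe.map f mx ≡ just y →
  ∃ λ x → mx ≡ just x × f x ≡ y
map-just⁻¹ f (just x) e = x , refl , just-injective e

_≐_ : ∀ {n} → Parent n → Parent n → Set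
p ≐ q = ∀ i → p i ≡ q i

iter-cong : ∀ {n} (p q : Parent n) → p ≐ q → ∀ m i → iter p m i ≡ iter q m i
iter-cong p q p≐q zero    i = refl
iter-cong p q p≐q (suc m) i rewrite p≐q i with q i
... | just j  = iter-cong p q p≐q m j
... | nothing = refl

InS-cong : ∀ {n} (p q : Parent n) → p ≐ q → ∀ π → InS p π → InS q π
InS-cong p q p≐q π π∈Sp i j (m , path) = π∈Sp i j (m , trans (iter-cong p q p≐q (suc (toℕ m)) i) path)

≐-sym : ∀ {n} {p q : Parent n} → p ≐ q → q ≐ p
≐-sym p≐q i = sym (p≐q i)

≟ₚ-invariant : ∀ {n} {q F : Parent n} → q ≐ F → ∀ p → does (q ≟ₚ p) ≡ does (F ≟ₚ p)
≟ₚ-invariant q≐F p =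
  does-⇔ (mk⇔ (λ q≐p i → trans (sym (q≐F i)) (q≐p i)) (λ F≐p i → trans (q≐F i) (F≐p i))) (_ ≟ₚ p) (_ ≟ₚ p)

InS?-invariant : ∀ {n} {q F : Parent n} → q ≐ F → ∀ π → does (InS? q π) ≡ does (InS? F π)
InS?-invariant {q = q} {F} q≐F π =
  does-⇔ (mk⇔ (InS-cong q F q≐F π) (InS-cong F q (≐-sym q≐F) π)) (InS? q π) (InS? F π)

parent-reach : ∀ {n} (p : Parent n) {i j} → p i ≡ just j → Reach p i j
parent-reach {suc n} p e = Fin.zero , cong (maybe′ just nothing) e

heap-parent : ∀ {n} (p : Parent n) → HeapOrdered p → ∀ {i j} → p i ≡ just j → j Fin.< i
heap-parent p (_ , decreasing) e = decreasing _ _ (parent-reach p e)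

-- A forest on Fin n read as a parent function on ℕ (vertices ≥ n are roots).
parentℕ : ∀ {n} → Parent n → ℕ → Maybe ℕ
parentℕ {n} p m with m <? n
... | yes m<n = Maybe.map toℕ (p (fromℕ< m<n))
... | no  _   = nothing

parentℕ-toℕ : ∀ {n} (p : Parent n) i → parentℕ p (toℕ i) ≡ Maybe.map toℕ (p i)
parentℕ-toℕ {n} p i with toℕ i <? n
... | yes i<n = cong (Maybe.map toℕ ∘ p) (Finₚ.fromℕ<-toℕ i i<n)
... | no  i≮n = ⊥-elim (i≮n (Finₚ.toℕ<n i))

parentℕ-edge : ∀ {n} (p : Parent n) {m a} → parentℕ p m ≡ just a →
  ∃ λ i → ∃ λ j → toℕ i ≡ m × toℕ j ≡ a × p i ≡ just j
parentℕ-edge {n} p {m} e with m <? n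
... | yes m<n with map-just⁻¹ toℕ (p (fromℕ< m<n)) e
...   | j , pe , refl = fromℕ< m<n , j , Finₚ.toℕ-fromℕ< m<n , refl , pe
parentℕ-edge p () | no _

parentℕ-heap : ∀ {n} (p : Parent n) → HeapOrdered p → HeapParent (parentℕ p)
parentℕ-heap p heap m a e with parentℕ-edge p e
... | i , j , refl , refl , pe = heap-parent p heap pe

key : ∀ {n} → Parent n → ℕ
key {n} p = Insertion.code (parentℕ p) n

-- The canonical permutation of a heap-ordered forest F: its inverse sends each vertex
-- to its position in the insertion sequence.
module Canonical {n : ℕ} (F : Parent n) (heapF : HeapOrdered F) where
  private
    open Insertion (parentℕ F)
    heapℕ : HeapParent (parentℕ F)
    heapℕ = parentℕ-heap F heapF

    position : Fin n → Fin n
    position i = fromℕ< (pos<m heapℕ n (toℕ i) (Finₚ.toℕ<n i))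

    position-injective : ∀ {i j} → position i ≡ position j → i ≡ j
    position-injective {i} {j} e = Finₚ.toℕ-injective
      (pos-injective heapℕ n (Finₚ.toℕ<n i) (Finₚ.toℕ<n j)
        (trans (sym (Finₚ.toℕ-fromℕ< _)) (trans (cong toℕ e) (Finₚ.toℕ-fromℕ< _))))

  canonical : Permutation′ n
  canonical = proj₁ (injection⇒permutation position position-injective)

  canonical⁻¹ : ∀ i → toℕ (canonical ⟨$⟩ˡ i) ≡ pos n (toℕ i)
  canonical⁻¹ i = trans (cong toℕ (proj₂ (injection⇒permutation position position-injective) i))
                        (Finₚ.toℕ-fromℕ< _)

  private
    edge : ∀ {i j} → F i ≡ just j → pos n (toℕ j) < pos n (toℕ i)
    edge {i} e = parent-before heapℕ n (toℕ i) (Finₚ.toℕ<n i) (trans (parentℕ-toℕ F i) (cong (Maybe.map toℕ) e))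

    path : ∀ m i j → iter F (suc m) i ≡ just j → pos n (toℕ j) < pos n (toℕ i)
    path m i j e with F i in Fi
    path zero    i j refl | just k = edge Fi
    path (suc m) i j e    | just k = ℕₚ.<-trans (path m k j e) (edge Fi)

  canonical∈S : InS F canonical
  canonical∈S i j (m , e) = subst₂ _<_ (sym (canonical⁻¹ j)) (sym (canonical⁻¹ i)) (path (toℕ m) i j e)

  triangular : (G : Parent n) → HeapOrdered G → InS G canonical → G ≐ F ⊎ key G < key F
  triangular G heapG canonical∈SG
    with Triangularity.code-compare (parentℕ F) (parentℕ G) heapℕ (parentℕ-heap G heapG) n compatible n ℕₚ.≤-refl
    where
    compatible : ∀ m a → m < n → parentℕ G m ≡ just a → pos n a < pos n m
    compatible m a _ e with parentℕ-edge G e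
    ... | i , j , refl , refl , Gi≡j =
      subst₂ _<_ (canonical⁻¹ j) (canonical⁻¹ i) (canonical∈SG i j (parent-reach G Gi≡j))
  ... | inj₂ smaller = inj₂ smaller
  ... | inj₁ agree   = inj₁ λ i → map-injective Finₚ.toℕ-injective
          (trans (sym (parentℕ-toℕ G i)) (trans (agree (toℕ i) (Finₚ.toℕ<n i)) (parentℕ-toℕ F i)))

-- h increases along every oriented path away from the roots.  Membership in S_F is
-- the special case InS p π = Increasing p (π ⟨$⟩ˡ_).
Increasing : ∀ {n N} → Parent n → (Fin n → Fin N) → Set
Increasing p h = ∀ i j → Reach p i j → h j Fin.< h i

iter-act : ∀ {n} (σ : Permutation′ n) (p : Parent n) m j →
  iter (act σ p) m j ≡ Maybe.map (σ ⟨$⟩ʳ_) (iter p m (σ ⟨$⟩ˡ j))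
iter-act σ p zero    j = cong just (sym (inverseʳ σ))
iter-act σ p (suc m) j with p (σ ⟨$⟩ˡ j)
... | just x  = trans (iter-act σ p m (σ ⟨$⟩ʳ x)) (cong (λ z → Maybe.map (σ ⟨$⟩ʳ_) (iter p m z)) (inverseˡ σ))
... | nothing = refl

reach-act⁻ : ∀ {n} (σ : Permutation′ n) (p : Parent n) {i j} →
  Reach (act σ p) i j → Reach p (σ ⟨$⟩ˡ i) (σ ⟨$⟩ˡ j)
reach-act⁻ σ p {i} (m , e) with map-just⁻¹ (σ ⟨$⟩ʳ_) _ (trans (sym (iter-act σ p (suc (toℕ m)) i)) e)
... | z , ze , refl = m , trans ze (cong just (sym (inverseˡ σ)))

reach-act⁺ : ∀ {n} (σ : Permutation′ n) (p : Parent n) {i j} →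
  Reach p i j → Reach (act σ p) (σ ⟨$⟩ʳ i) (σ ⟨$⟩ʳ j)
reach-act⁺ σ p {i} (m , e) = m , trans (iter-act σ p (suc (toℕ m)) (σ ⟨$⟩ʳ i))
  (cong (Maybe.map (σ ⟨$⟩ʳ_)) (trans (cong (iter p (suc (toℕ m))) (inverseˡ σ)) e))

InS-act⇒ : ∀ {n} (σ : Permutation′ n) (p : Parent n) π →
  InS (act σ p) π → Increasing p (λ y → π ⟨$⟩ˡ (σ ⟨$⟩ʳ y))
InS-act⇒ σ p π π∈S i j path = π∈S _ _ (reach-act⁺ σ p path)

InS-act⇐ : ∀ {n} (σ : Permutation′ n) (p : Parent n) π →
  Increasing p (λ y → π ⟨$⟩ˡ (σ ⟨$⟩ʳ y)) → InS (act σ p) π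
InS-act⇐ σ p π incr i j path =
  subst₂ (λ a b → π ⟨$⟩ˡ a Fin.< π ⟨$⟩ˡ b) (inverseʳ σ) (inverseʳ σ) (incr _ _ (reach-act⁻ σ p path))

-- In a heap-ordered forest a path of length m+1 descends by at least m+1 labels, so it
-- is shorter than the number of vertices: such paths witness reachability.
iter-descends : ∀ {n} (p : Parent n) → HeapOrdered p →
  ∀ m {a b} → iter p (suc m) a ≡ just b → toℕ b +ℕ suc m ≤ toℕ a
iter-descends p heap m {a} e with p a in pa
iter-descends p heap zero    {a} refl | just c = subst (_≤ toℕ a) (ℕₚ.+-comm 1 (toℕ c)) (heap-parent p heap pa)
iter-descends p heap (suc m) {a} {b} e | just c = begin
    toℕ b +ℕ suc (suc m)   ≡⟨ ℕₚ.+-suc (toℕ b) (suc m) ⟩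
    suc (toℕ b +ℕ suc m)   ≤⟨ s≤s (iter-descends p heap m e) ⟩
    suc (toℕ c)            ≤⟨ heap-parent p heap pa ⟩
    toℕ a                  ∎
  where open ℕₚ.≤-Reasoning

iter⇒reach : ∀ {n} (p : Parent n) → HeapOrdered p → ∀ m {a b} → iter p (suc m) a ≡ just b → Reach p a b
iter⇒reach {n} p heap m {a} {b} e =
  fromℕ< m<n , subst (λ z → iter p (suc z) a ≡ just b) (sym (Finₚ.toℕ-fromℕ< m<n)) e
  where
  m<n : m < n
  m<n = begin-strict
    m                  ≤⟨ ℕₚ.n≤1+n m ⟩
    suc m              ≤⟨ ℕₚ.m≤n+m (suc m) (toℕ b) ⟩
    toℕ b +ℕ suc m     ≤⟨ iter-descends p heap m e ⟩
    toℕ a              <⟨ Finₚ.toℕ<n a ⟩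
    n                  ∎
    where open ℕₚ.≤-Reasoning

module Product {k l : ℕ} (p : Parent k) (q : Parent l) where

  iter-left : ∀ m a → iter (p ·ᶠ q) m (a ↑ˡ l) ≡ Maybe.map (_↑ˡ l) (iter p m a)
  iter-left zero    a = refl
  iter-left (suc m) a rewrite Finₚ.splitAt-↑ˡ k a l with p a
  ... | just b  = iter-left m b
  ... | nothing = refl

  iter-right : ∀ m b → iter (p ·ᶠ q) m (k ↑ʳ b) ≡ Maybe.map (k ↑ʳ_) (iter q m b)
  iter-right zero    b = refl
  iter-right (suc m) b rewrite Finₚ.splitAt-↑ʳ k l b with q b
  ... | just c  = iter-right m c
  ... | nothing = refl

  reach-left : ∀ {a b} → Reach p a b → Reach (p ·ᶠ q) (a ↑ˡ l) (b ↑ˡ l)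
  reach-left {a} {b} (m , e) = m ↑ˡ l ,
    subst (λ z → iter (p ·ᶠ q) (suc z) (a ↑ˡ l) ≡ just (b ↑ˡ l)) (sym (Finₚ.toℕ-↑ˡ m l))
      (trans (iter-left (suc (toℕ m)) a) (cong (Maybe.map (_↑ˡ l)) e))

  reach-right : ∀ {a b} → Reach q a b → Reach (p ·ᶠ q) (k ↑ʳ a) (k ↑ʳ b)
  reach-right {a} {b} (m , e) = fromℕ< m<k+l ,
    subst (λ z → iter (p ·ᶠ q) (suc z) (k ↑ʳ a) ≡ just (k ↑ʳ b)) (sym (Finₚ.toℕ-fromℕ< m<k+l))
      (trans (iter-right (suc (toℕ m)) a) (cong (Maybe.map (k ↑ʳ_)) e))
    where
    m<k+l : toℕ m < k +ℕ l
    m<k+l = ℕₚ.<-≤-trans (Finₚ.toℕ<n m) (ℕₚ.m≤n+m l k)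

  block : ∀ x → (∃ λ a → x ≡ a ↑ˡ l) ⊎ (∃ λ b → x ≡ k ↑ʳ b)
  block x with splitAt k x in split-x
  ... | inj₁ a = inj₁ (a , sym (Finₚ.splitAt⁻¹-↑ˡ split-x))
  ... | inj₂ b = inj₂ (b , sym (Finₚ.splitAt⁻¹-↑ʳ split-x))

  module _ (heap-p : HeapOrdered p) (heap-q : HeapOrdered q) where

    reach-split : ∀ {x y} → Reach (p ·ᶠ q) x y →
      (∃ λ a → ∃ λ b → x ≡ a ↑ˡ l × y ≡ b ↑ˡ l × Reach p a b) ⊎
      (∃ λ a → ∃ λ b → x ≡ k ↑ʳ a × y ≡ k ↑ʳ b × Reach q a b)
    reach-split {x} (m , e) with block x
    ... | inj₁ (a , refl)
      with map-just⁻¹ (_↑ˡ l) (iter p (suc (toℕ m)) a) (trans (sym (iter-left (suc (toℕ m)) a)) e)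
    ...   | b , e′ , refl = inj₁ (a , b , refl , refl , iter⇒reach p heap-p (toℕ m) e′)
    reach-split {x} (m , e) | inj₂ (a , refl)
      with map-just⁻¹ (k ↑ʳ_) (iter q (suc (toℕ m)) a) (trans (sym (iter-right (suc (toℕ m)) a)) e)
    ...   | b , e′ , refl = inj₂ (a , b , refl , refl , iter⇒reach q heap-q (toℕ m) e′)

    increasing-product⇒ : ∀ {N} (h : Fin (k +ℕ l) → Fin N) → Increasing (p ·ᶠ q) h →
      Increasing p (h ∘ (_↑ˡ l)) × Increasing q (h ∘ (k ↑ʳ_))
    increasing-product⇒ h incr = (λ a b path → incr _ _ (reach-left path))
                               , (λ a b path → incr _ _ (reach-right path))

    increasing-product⇐ : ∀ {N} (h : Fin (k +ℕ l) → Fin N) →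
      Increasing p (h ∘ (_↑ˡ l)) → Increasing q (h ∘ (k ↑ʳ_)) → Increasing (p ·ᶠ q) h
    increasing-product⇐ h incr-p incr-q x y path with reach-split path
    ... | inj₁ (a , b , refl , refl , path-p) = incr-p a b path-p
    ... | inj₂ (a , b , refl , refl , path-q) = incr-q a b path-q

    -- For a shuffle ε, relabelling the product by ε⁻¹ keeps it heap-ordered: ε⁻¹
    -- is increasing on each block.
    act-shuffle-heap : (ε : Permutation′ (k +ℕ l)) → IsShuffle k l ε → HeapOrdered (act (inv ε) (p ·ᶠ q))
    act-shuffle-heap ε (shuffle-left , shuffle-right) = (λ i path → ℕₚ.<-irrefl refl (decreasing i i path)) , decreasing
      where
      back : ∀ {x y} → ε ⟨$⟩ʳ x ≡ y → ε ⟨$⟩ˡ y ≡ x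
      back e = trans (cong (ε ⟨$⟩ˡ_) (sym e)) (inverseˡ ε)

      decreasing : ∀ i j → Reach (act (inv ε) (p ·ᶠ q)) i j → j Fin.< i
      decreasing i j path with reach-split (reach-act⁻ (inv ε) (p ·ᶠ q) path)
      ... | inj₁ (a , b , ea , eb , path-p) =
        subst₂ Fin._<_ (back eb) (back ea) (shuffle-left b a (proj₂ heap-p a b path-p))
      ... | inj₂ (a , b , ea , eb , path-q) =
        subst₂ Fin._<_ (back eb) (back ea) (shuffle-right b a (proj₂ heap-q a b path-q))

-- Fix a permutation π of Fin (k + l) and put h = π⁻¹ ∘ ε⁻¹.  The standardizations π₁, π₂
-- of the restrictions of h to the two blocks are the permutations at which Θ(𝕋^σ) and
-- Θ(𝕋^τ) are evaluated when computing Θ(ε⁻¹.(𝕋^σ 𝕋^τ)) at π.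
module Blocks {k l : ℕ} (ε π : Permutation′ (k +ℕ l)) where

  h : Fin (k +ℕ l) → Fin (k +ℕ l)
  h y = π ⟨$⟩ˡ (ε ⟨$⟩ˡ y)

  h-injective : Injective _≡_ _≡_ h
  h-injective = inverse-injective ε ∘ inverse-injective π

  g₁ : Fin k → Fin (k +ℕ l)
  g₁ a = h (a ↑ˡ l)

  g₂ : Fin l → Fin (k +ℕ l)
  g₂ b = h (k ↑ʳ b)

  module S₁ = Standardization g₁
  module S₂ = Standardization g₂

  g₁-injective : Injective _≡_ _≡_ g₁
  g₁-injective = Finₚ.↑ˡ-injective l _ _ ∘ h-injective

  g₂-injective : Injective _≡_ _≡_ g₂
  g₂-injective = Finₚ.↑ʳ-injective k _ _ ∘ h-injective

  π₁ : Permutation′ k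
  π₁ = S₁.std g₁-injective

  π₂ : Permutation′ l
  π₂ = S₂.std g₂-injective

  module _ (p : Parent k) (q : Parent l) (heap-p : HeapOrdered p) (heap-q : HeapOrdered q) where
    open Product p q

    InS-act-product⇒ : InS (act (inv ε) (p ·ᶠ q)) π → InS p π₁ × InS q π₂
    InS-act-product⇒ π∈S with increasing-product⇒ heap-p heap-q h (InS-act⇒ (inv ε) (p ·ᶠ q) π π∈S)
    ... | incr₁ , incr₂ = (λ i j path → S₁.std-preserves g₁-injective j i (incr₁ i j path))
                        , (λ i j path → S₂.std-preserves g₂-injective j i (incr₂ i j path))

    InS-act-product⇐ : InS p π₁ → InS q π₂ → InS (act (inv ε) (p ·ᶠ q)) π
    InS-act-product⇐ π₁∈S π₂∈S = InS-act⇐ (inv ε) (p ·ᶠ q) π (increasing-product⇐ heap-p heap-q h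
      (λ i j path → S₁.std-reflects g₁-injective j i (π₁∈S i j path))
      (λ i j path → S₂.std-reflects g₂-injective j i (π₂∈S i j path)))

-- The summand of ζ on the right-hand side is 𝕋^{ρ ζ} with ρ ζ = ζ⁻¹ ∘ (σ ⊗ τ) ∘ ε.  Since
-- Θ(𝕋^{ρ ζ}) = (ρ ζ)⁻¹, it contributes at π exactly when π matches ζ, i.e. π = (ρ ζ)⁻¹,
-- equivalently h = ζ⁻¹ ∘ (σ ⊗ τ).
module Matching {k l : ℕ} (σ : Permutation′ k) (τ : Permutation′ l) (ε π : Permutation′ (k +ℕ l)) where
  open Blocks {k} {l} ε π

  Matches : Permutation′ (k +ℕ l) → Set
  Matches ζ = π ≈ₚ inv ((inv ζ ○ (σ ⊗ τ)) ○ ε)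

  matches⇒ : ∀ ζ → Matches ζ → ∀ y → h y ≡ ζ ⟨$⟩ˡ ((σ ⊗ τ) ⟨$⟩ʳ y)
  matches⇒ ζ match y = trans (cong (π ⟨$⟩ˡ_) (sym π-at-x)) (inverseˡ π)
    where
    x : Fin (k +ℕ l)
    x = ζ ⟨$⟩ˡ ((σ ⊗ τ) ⟨$⟩ʳ y)

    π-at-x : π ⟨$⟩ʳ x ≡ ε ⟨$⟩ˡ y
    π-at-x = trans (match x)
      (cong (ε ⟨$⟩ˡ_) (trans (cong ((σ ⊗ τ) ⟨$⟩ˡ_) (inverseʳ ζ)) (inverseˡ (σ ⊗ τ))))

  matches⇐ : ∀ ζ → (∀ y → h y ≡ ζ ⟨$⟩ˡ ((σ ⊗ τ) ⟨$⟩ʳ y)) → Matches ζ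
  matches⇐ ζ h≡ i = trans (sym (cong (π ⟨$⟩ʳ_) h-at-y)) (inverseʳ π)
    where
    y : Fin (k +ℕ l)
    y = (σ ⊗ τ) ⟨$⟩ˡ (ζ ⟨$⟩ʳ i)

    h-at-y : h y ≡ i
    h-at-y = trans (h≡ y) (trans (cong (ζ ⟨$⟩ˡ_) (inverseʳ (σ ⊗ τ))) (inverseˡ ζ))

  matches-unique : ∀ ζ ζ′ → Matches ζ → Matches ζ′ → ζ ≈ₚ ζ′
  matches-unique ζ ζ′ m m′ = ≈ₚ-fromInverse {π = ζ} {ρ = ζ′} λ x →
    trans (determined ζ m x) (sym (determined ζ′ m′ x))
    where
    determined : ∀ ζ → Matches ζ → ∀ x → ζ ⟨$⟩ˡ x ≡ h ((σ ⊗ τ) ⟨$⟩ˡ x)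
    determined ζ m x = trans (cong (ζ ⟨$⟩ˡ_) (sym (inverseʳ (σ ⊗ τ)))) (sym (matches⇒ ζ m _))

  -- If π matches a shuffle ζ, then on each block h is an increasing map composed with σ
  -- (resp. τ), so π₁ = σ⁻¹ and π₂ = τ⁻¹.
  matches⇒std : ∀ ζ → IsShuffle k l ζ → Matches ζ → π₁ ≈ₚ inv σ × π₂ ≈ₚ inv τ
  matches⇒std ζ (shuffle-left , shuffle-right) m =
      S₁.std-of-increasing∘ g₁-injective σ (λ a → ζ ⟨$⟩ˡ (a ↑ˡ l)) shuffle-left
        (λ a → trans (matches⇒ ζ m (a ↑ˡ l)) (cong (ζ ⟨$⟩ˡ_) (⊗-left σ τ a)))
    , S₂.std-of-increasing∘ g₂-injective τ (λ b → ζ ⟨$⟩ˡ (k ↑ʳ b)) shuffle-right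
        (λ b → trans (matches⇒ ζ m (k ↑ʳ b)) (cong (ζ ⟨$⟩ˡ_) (⊗-right σ τ b)))

  -- Conversely, if π₁ = σ⁻¹ and π₂ = τ⁻¹, then ζ₀ = ((σ ⊗ τ) ∘ h⁻¹)⁻¹ is a shuffle matched by π.
  std⇒matches : π₁ ≈ₚ inv σ → π₂ ≈ₚ inv τ →
    Σ (Permutation′ (k +ℕ l)) λ ζ → IsShuffle k l ζ × Matches ζ
  std⇒matches π₁≈σ⁻¹ π₂≈τ⁻¹ =
    ζ₀ , (shuffle-left , shuffle-right) , matches⇐ ζ₀ (λ y → cong h (sym (inverseˡ (σ ⊗ τ))))
    where
    ζ₀ : Permutation′ (k +ℕ l)
    ζ₀ = inv ((inv π ○ inv ε) ○ inv (σ ⊗ τ))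

    shuffle-left : ∀ i j → i Fin.< j → ζ₀ ⟨$⟩ˡ (i ↑ˡ l) Fin.< ζ₀ ⟨$⟩ˡ (j ↑ˡ l)
    shuffle-left i j i<j = subst₂ Fin._<_ (cong h (sym (⊗-left⁻¹ σ τ i))) (cong h (sym (⊗-left⁻¹ σ τ j)))
      (S₁.std-inverse-increasing g₁-injective σ π₁≈σ⁻¹ i j i<j)

    shuffle-right : ∀ i j → i Fin.< j → ζ₀ ⟨$⟩ˡ (k ↑ʳ i) Fin.< ζ₀ ⟨$⟩ˡ (k ↑ʳ j)
    shuffle-right i j i<j = subst₂ Fin._<_ (cong h (sym (⊗-right⁻¹ σ τ i))) (cong h (sym (⊗-right⁻¹ σ τ j)))
      (S₂.std-inverse-increasing g₂-injective τ π₂≈τ⁻¹ i j i<j)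

  matches-resp : ∀ ζ ζ′ → ζ ≈ₚ ζ′ → Matches ζ → Matches ζ′
  matches-resp ζ ζ′ ζ≈ζ′ m =
    matches⇐ ζ′ (λ y → trans (matches⇒ ζ m y) (≈ₚ-inverse {π = ζ} {ρ = ζ′} ζ≈ζ′ _))

module Linear {c ℓ : Level} (K : Field c ℓ) where
  open Field K hiding (inverse) renaming (refl to ≈-refl; sym to ≈-sym; trans to ≈-trans)
  open Lin K
  open import Relation.Binary.Reasoning.Setoid setoid
  open import Algebra.Properties.Group +-group using (ε⁻¹≈ε; x∙y⁻¹≈ε⇒x≈y)
  open import Algebra.Properties.AbelianGroup +-abelianGroup using (⁻¹-∙-comm)

  -- The coefficient functionals coeff and Θcoeff are both instances of one construction:
  -- the sum of the coefficients of those terms whose forest passes a boolean test.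
  weight : ∀ {n} → (Parent n → Bool) → Comb n → Carrier
  weight b []            = 0#
  weight b ((a , q) ∷ v) = (if b q then a else 0#) + weight b v

  coeff≡weight : ∀ {n} (v : Comb n) p → coeff v p ≡ weight (λ q → does (q ≟ₚ p)) v
  coeff≡weight []            p = refl
  coeff≡weight ((a , q) ∷ v) p = cong (_ +_) (coeff≡weight v p)

  Θcoeff≡weight : ∀ {n} (v : Comb n) π → Θcoeff v π ≡ weight (λ q → does (InS? q π)) v
  Θcoeff≡weight []            π = refl
  Θcoeff≡weight ((a , q) ∷ v) π = cong (_ +_) (Θcoeff≡weight v π)

  if-zero : ∀ β {x} → x ≈ 0# → (if β then x else 0#) ≈ 0#
  if-zero true  x≈0 = x≈0
  if-zero false _   = ≈-refl

  weight-++ : ∀ {n} (b : Parent n → Bool) v w → weight b (v ++ w) ≈ weight b v + weight b w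
  weight-++ b []            w = ≈-sym (+-identityˡ _)
  weight-++ b ((a , q) ∷ v) w = ≈-trans (+-congˡ (weight-++ b v w)) (≈-sym (+-assoc _ _ _))

  weight-cong : ∀ {n} (b b′ : Parent n → Bool) v → All (λ e → b (proj₂ e) ≡ b′ (proj₂ e)) v →
    weight b v ≈ weight b′ v
  weight-cong b b′ []            []       = ≈-refl
  weight-cong b b′ ((a , q) ∷ v) (e ∷ es) rewrite e = +-congˡ (weight-cong b b′ v es)

  negate : ∀ {n} → Comb n → Comb n
  negate = List.map (λ e → - proj₁ e , proj₂ e)

  weight-negate : ∀ {n} (b : Parent n → Bool) v → weight b (negate v) ≈ - weight b v
  weight-negate b []            = ≈-sym ε⁻¹≈ε
  weight-negate b ((a , q) ∷ v) = ≈-trans (+-cong (if-negate (b q)) (weight-negate b v)) (⁻¹-∙-comm _ _)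
    where
    if-negate : ∀ β → (if β then - a else 0#) ≈ - (if β then a else 0#)
    if-negate true  = ≈-refl
    if-negate false = ≈-sym ε⁻¹≈ε

  if-cong : ∀ β {x y} → x ≈ y → (if β then x else 0#) ≈ (if β then y else 0#)
  if-cong true  x≈y = x≈y
  if-cong false _   = ≈-refl

  if-+ : ∀ β x y → (if β then x + y else 0#) ≈ (if β then x else 0#) + (if β then y else 0#)
  if-+ true  x y = ≈-refl
  if-+ false x y = ≈-sym (+-identityˡ 0#)

  without : ∀ {n} → Parent n → Comb n → Comb n
  without F = filter (λ e → ¬? (proj₂ e ≟ₚ F))

  weight-extract : ∀ {n} (b : Parent n → Bool) (F : Parent n) → (∀ q → q ≐ F → b q ≡ b F) →
    ∀ v → weight b v ≈ weight b (without F v) + (if b F then coeff v F else 0#)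
  weight-extract b F respects [] = ≈-sym (≈-trans (+-identityˡ _) (if-zero (b F) ≈-refl))
  weight-extract b F respects ((a , q) ∷ v) with q ≟ₚ F
  ... | yes q≐F rewrite Listₚ.filter-reject (λ e → ¬? (proj₂ e ≟ₚ F)) {x = a , q} {xs = v} (λ q≭F → q≭F q≐F)
                      | dec-true (q ≟ₚ F) q≐F
                      | respects q q≐F = begin
    A + weight b v                                   ≈⟨ +-congˡ (weight-extract b F respects v) ⟩
    A + (weight b (without F v) + C)                 ≈⟨ ≈-sym (+-assoc _ _ _) ⟩
    (A + weight b (without F v)) + C                 ≈⟨ +-congʳ (+-comm _ _) ⟩
    (weight b (without F v) + A) + C                 ≈⟨ +-assoc _ _ _ ⟩
    weight b (without F v) + (A + C)                 ≈⟨ +-congˡ (≈-sym (if-+ (b F) a (coeff v F))) ⟩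
    weight b (without F v) + (if b F then a + coeff v F else 0#) ∎
    where
    A C : Carrier
    A = if b F then a else 0#
    C = if b F then coeff v F else 0#
  ... | no q≭F rewrite Listₚ.filter-accept (λ e → ¬? (proj₂ e ≟ₚ F)) {x = a , q} {xs = v} q≭F
                     | dec-false (q ≟ₚ F) q≭F = begin
    A + weight b v                                   ≈⟨ +-congˡ (weight-extract b F respects v) ⟩
    A + (weight b (without F v) + C)                 ≈⟨ ≈-sym (+-assoc _ _ _) ⟩
    (A + weight b (without F v)) + C                 ≈⟨ +-congˡ (if-cong (b F) (≈-sym (+-identityˡ _))) ⟩
    (A + weight b (without F v)) + (if b F then 0# + coeff v F else 0#) ∎
    where
    A C : Carrier
    A = if b q then a else 0#
    C = if b F then coeff v F else 0#

  Θ-at-canonical : ∀ {n} (F : Parent n) (heapF : HeapOrdered F) (v : Comb n) → InHho v →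
    All (λ e → key F ≤ key (proj₂ e)) v → Θcoeff v (Canonical.canonical F heapF) ≈ coeff v F
  Θ-at-canonical F heapF v heap-v minimal = begin
    Θcoeff v canonical                        ≡⟨ Θcoeff≡weight v canonical ⟩
    weight (λ q → does (InS? q canonical)) v
      ≈⟨ weight-cong _ _ v (All.zipWith (λ {e} → same-test (proj₂ e)) (heap-v , minimal)) ⟩
    weight (λ q → does (q ≟ₚ F)) v            ≡⟨ sym (coeff≡weight v F) ⟩
    coeff v F                                 ∎
    where
    open Canonical F heapF
    same-test : ∀ q → HeapOrdered q × key F ≤ key q → does (InS? q canonical) ≡ does (q ≟ₚ F)
    same-test q (heap-q , F≤q) = does-⇔ (mk⇔ equal (λ q≐F → InS-cong F q (≐-sym q≐F) canonical canonical∈S))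
                                        (InS? q canonical) (q ≟ₚ F)
      where
      equal : InS q canonical → q ≐ F
      equal canonical∈Sq with triangular q heap-q canonical∈Sq
      ... | inj₁ q≐F = q≐F
      ... | inj₂ q<F = ⊥-elim (ℕₚ.<-irrefl refl (ℕₚ.<-≤-trans q<F F≤q))

  module _ {n} (F : Parent n) (v : Comb n) (F≈0 : coeff v F ≈ 0#) where
    private
      drop-F : ∀ b → (∀ q → q ≐ F → b q ≡ b F) → weight b v ≈ weight b (without F v)
      drop-F b invariant = begin
        weight b v                                               ≈⟨ weight-extract b F invariant v ⟩
        weight b (without F v) + (if b F then coeff v F else 0#)  ≈⟨ +-congˡ (if-zero (b F) F≈0) ⟩
        weight b (without F v) + 0#                               ≈⟨ +-identityʳ _ ⟩
        weight b (without F v)                                    ∎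

    coeff-without : ∀ p → coeff v p ≈ coeff (without F v) p
    coeff-without p = begin
      coeff v p                               ≡⟨ coeff≡weight v p ⟩
      weight (λ q → does (q ≟ₚ p)) v          ≈⟨ drop-F _ (λ q q≐F → ≟ₚ-invariant q≐F p) ⟩
      weight (λ q → does (q ≟ₚ p)) (without F v) ≡⟨ sym (coeff≡weight (without F v) p) ⟩
      coeff (without F v) p                   ∎

    Θ-without : ∀ π → Θcoeff v π ≈ Θcoeff (without F v) π
    Θ-without π = begin
      Θcoeff v π                                 ≡⟨ Θcoeff≡weight v π ⟩
      weight (λ q → does (InS? q π)) v           ≈⟨ drop-F _ (λ q q≐F → InS?-invariant q≐F π) ⟩
      weight (λ q → does (InS? q π)) (without F v) ≡⟨ sym (Θcoeff≡weight (without F v) π) ⟩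
      Θcoeff (without F v) π                     ∎

  without-shorter : ∀ {n} (F : Parent n) (v : Comb n) → Any (λ e → proj₂ e ≐ F) v → length (without F v) < length v
  without-shorter F v F∈v =
    Listₚ.filter-notAll (λ e → ¬? (proj₂ e ≟ₚ F)) v (Any.map (λ q≐F q≭F → q≭F q≐F) F∈v)

  -- Induction on the
  -- number of terms: the forest F of minimal key has total coefficient Θ(v)(π_F) = 0,
  -- and removing its terms leaves a shorter combination whose image still vanishes.
  Θ-kernel : ∀ {n} fuel (v : Comb n) → length v ≤ fuel → InHho v →
    (∀ π → Θcoeff v π ≈ 0#) → ∀ p → coeff v p ≈ 0#
  Θ-kernel _          []          _      _      _    p = ≈-refl
  Θ-kernel (suc fuel) v@(e₀ ∷ v₀) |v|≤1+ heap-v Θv≈0 p =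
    ≈-trans (coeff-without F v F≈0 p)
            (Θ-kernel fuel (without F v) (ℕₚ.<⇒≤pred (ℕₚ.<-≤-trans (without-shorter F v F∈v) |v|≤1+))
                      (Allₚ.filter⁺ (λ e → ¬? (proj₂ e ≟ₚ F)) heap-v)
                      (λ π → ≈-trans (≈-sym (Θ-without F v F≈0 π)) (Θv≈0 π)) p)
    where
    minimal-term : Carrier × Parent _
    minimal-term = argmin (key ∘ proj₂) e₀ v₀

    F : Parent _
    F = proj₂ minimal-term

    heapF : HeapOrdered F
    heapF = argmin-all (key ∘ proj₂) {P = HeapOrdered ∘ proj₂} (All.head heap-v) (All.tail heap-v)

    minimal : All (λ e → key F ≤ key (proj₂ e)) v
    minimal = f[argmin]≤f[⊤] {f = key ∘ proj₂} e₀ v₀ ∷ f[argmin]≤f[xs] {f = key ∘ proj₂} e₀ v₀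

    F∈v : Any (λ e → proj₂ e ≐ F) v
    F∈v with argmin-sel (key ∘ proj₂) e₀ v₀
    ... | inj₁ is-e₀ = here (λ i → cong (λ e → proj₂ e i) (sym is-e₀))
    ... | inj₂ ∈v₀   = there (Any.map (λ is-e i → cong (λ e → proj₂ e i) (sym is-e)) ∈v₀)

    F≈0 : coeff v F ≈ 0#
    F≈0 = ≈-trans (≈-sym (Θ-at-canonical F heapF v heap-v minimal)) (Θv≈0 _)

  Θ-injective : ∀ {n} (v w : Comb n) → InHho v → InHho w → (∀ π → Θcoeff v π ≈ Θcoeff w π) → v ≋ w
  Θ-injective v w heap-v heap-w Θv≈Θw p = x∙y⁻¹≈ε⇒x≈y _ _ (begin
    coeff v p - coeff w p                 ≡⟨ cong₂ _-_ (coeff≡weight v p) (coeff≡weight w p) ⟩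
    weight b v - weight b w               ≈⟨ ≈-sym (difference b) ⟩
    weight b (v ++ negate w)              ≡⟨ sym (coeff≡weight (v ++ negate w) p) ⟩
    coeff (v ++ negate w) p               ≈⟨ Θ-kernel _ (v ++ negate w) ℕₚ.≤-refl heap-difference Θ-difference p ⟩
    0#                                    ∎)
    where
    b : Parent _ → Bool
    b q = does (q ≟ₚ p)

    difference : ∀ b′ → weight b′ (v ++ negate w) ≈ weight b′ v - weight b′ w
    difference b′ = ≈-trans (weight-++ b′ v (negate w)) (+-congˡ (weight-negate b′ w))

    heap-difference : InHho (v ++ negate w)
    heap-difference = Allₚ.++⁺ heap-v (Allₚ.map⁺ heap-w)

    Θ-difference : ∀ π → Θcoeff (v ++ negate w) π ≈ 0#
    Θ-difference π = begin
      Θcoeff (v ++ negate w) π            ≡⟨ Θcoeff≡weight (v ++ negate w) π ⟩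
      weight inS (v ++ negate w)          ≈⟨ difference inS ⟩
      weight inS v - weight inS w         ≡⟨ cong₂ _-_ (sym (Θcoeff≡weight v π)) (sym (Θcoeff≡weight w π)) ⟩
      Θcoeff v π - Θcoeff w π             ≈⟨ +-congʳ (Θv≈Θw π) ⟩
      Θcoeff w π - Θcoeff w π             ≈⟨ -‿inverseʳ _ ⟩
      0#                                  ∎
      where
      inS : Parent _ → Bool
      inS q = does (InS? q π)

  weight-act : ∀ {n} (b : Parent n → Bool) (σ : Permutation′ n) v → weight b (σ ∙ v) ≡ weight (b ∘ act σ) v
  weight-act b σ []            = refl
  weight-act b σ ((a , q) ∷ v) = cong (_ +_) (weight-act b σ v)

  if-∧ : ∀ x y a d → (if x ∧ y then a * d else 0#) ≈ (if x then a else 0#) * (if y then d else 0#)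
  if-∧ true  true  a d = ≈-refl
  if-∧ true  false a d = ≈-sym (zeroʳ a)
  if-∧ false y     a d = ≈-sym (zeroˡ _)

  module _ {k l : ℕ} (b : Parent (k +ℕ l) → Bool) (b₁ : Parent k → Bool) (b₂ : Parent l → Bool)
           (factors : ∀ p q → HeapOrdered p → HeapOrdered q → b (p ·ᶠ q) ≡ b₁ p ∧ b₂ q) where

    weight-row : ∀ a p → HeapOrdered p → (w : Comb l) → InHho w →
      weight b (concatMap (λ f → (a * proj₁ f , p ·ᶠ proj₂ f) ∷ []) w) ≈ (if b₁ p then a else 0#) * weight b₂ w
    weight-row a p heap-p []            []               = ≈-sym (zeroʳ _)
    weight-row a p heap-p ((d , q) ∷ w) (heap-q ∷ heap-w) = begin
      (if b (p ·ᶠ q) then a * d else 0#) + weight b (concatMap (λ f → (a * proj₁ f , p ·ᶠ proj₂ f) ∷ []) w)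
        ≈⟨ +-cong (≈-trans (reflexive (cong (λ β → if β then a * d else 0#) (factors p q heap-p heap-q)))
                         (if-∧ (b₁ p) (b₂ q) a d))
                  (weight-row a p heap-p w heap-w) ⟩
      A * (if b₂ q then d else 0#) + A * weight b₂ w
        ≈⟨ ≈-sym (distribˡ _ _ _) ⟩
      A * ((if b₂ q then d else 0#) + weight b₂ w) ∎
      where
      A : Carrier
      A = if b₁ p then a else 0#

    weight-product : (v : Comb k) (w : Comb l) → InHho v → InHho w → weight b (v · w) ≈ weight b₁ v * weight b₂ w
    weight-product []            w []                heap-w = ≈-sym (zeroˡ _)
    weight-product ((a , p) ∷ v) w (heap-p ∷ heap-v) heap-w = begin
      weight b (row ++ (v · w))                         ≈⟨ weight-++ b row (v · w) ⟩
      weight b row + weight b (v · w)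
        ≈⟨ +-cong (weight-row a p heap-p w heap-w) (weight-product v w heap-v heap-w) ⟩
      A * weight b₂ w + weight b₁ v * weight b₂ w       ≈⟨ ≈-sym (distribʳ _ _ _) ⟩
      (A + weight b₁ v) * weight b₂ w                   ∎
      where
      row : Comb (k +ℕ l)
      row = concatMap (λ f → (a * proj₁ f , p ·ᶠ proj₂ f) ∷ []) w

      A : Carrier
      A = if b₁ p then a else 0#

  sumOver : ∀ {A : Set} → (A → Carrier) → List A → Carrier
  sumOver f []       = 0#
  sumOver f (x ∷ xs) = f x + sumOver f xs

  sumOver-cong : ∀ {A : Set} {f g : A → Carrier} xs → (∀ x → f x ≈ g x) → sumOver f xs ≈ sumOver g xs
  sumOver-cong []       f≈g = ≈-refl
  sumOver-cong (x ∷ xs) f≈g = +-cong (f≈g x) (sumOver-cong xs f≈g)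

  weight-∑ : ∀ {A : Set} {n} (b : Parent n → Bool) (xs : List A) (f : A → Comb n) →
    weight b (∑ xs f) ≈ sumOver (λ x → weight b (f x)) xs
  weight-∑ b []       f = ≈-refl
  weight-∑ b (x ∷ xs) f = ≈-trans (weight-++ b (f x) (∑ xs f)) (+-congˡ (weight-∑ b xs f))

  δ : ∀ {P : Set} → Dec P → Carrier
  δ p? = if does p? then 1# else 0#

  module _ {N : ℕ} (C : Permutation′ N → Set) (C? : ∀ ζ → Dec (C ζ)) where

    sum-δ-none : ∀ xs → ¬ Any C xs → sumOver (δ ∘ C?) xs ≈ 0#
    sum-δ-none []       _     = ≈-refl
    sum-δ-none (x ∷ xs) ¬C∈xs with C? x
    ... | yes Cx = ⊥-elim (¬C∈xs (here Cx))
    ... | no  _  = ≈-trans (+-identityˡ _) (sum-δ-none xs (¬C∈xs ∘ there))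

    sum-δ-one : (∀ ζ ζ′ → C ζ → C ζ′ → ζ ≈ₚ ζ′) →
      ∀ xs → AllPairs (λ a b → ¬ a ≈ₚ b) xs → Any C xs → sumOver (δ ∘ C?) xs ≈ 1#
    sum-δ-one unique (x ∷ xs) (x≉xs ∷ distinct) C∈x∷xs with C? x | C∈x∷xs
    ... | yes Cx  | _          = ≈-trans (+-congˡ (sum-δ-none xs (Allₚ.All¬⇒¬Any
                                       (All.map (λ x≉y Cy → x≉y (unique _ _ Cx Cy)) x≉xs))))
                                     (+-identityʳ _)
    ... | no  ¬Cx | here Cx    = ⊥-elim (¬Cx Cx)
    ... | no  _  | there C∈xs = ≈-trans (+-identityˡ _) (sum-δ-one unique xs distinct C∈xs)

  Θ-∑ : ∀ {A : Set} {n} (xs : List A) (f : A → Comb n) π →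
    Θcoeff (∑ xs f) π ≈ sumOver (λ x → Θcoeff (f x) π) xs
  Θ-∑ xs f π = begin
    Θcoeff (∑ xs f) π                        ≡⟨ Θcoeff≡weight (∑ xs f) π ⟩
    weight inS (∑ xs f)                      ≈⟨ weight-∑ inS xs f ⟩
    sumOver (λ x → weight inS (f x)) xs
      ≈⟨ sumOver-cong xs (λ x → reflexive (sym (Θcoeff≡weight (f x) π))) ⟩
    sumOver (λ x → Θcoeff (f x) π) xs        ∎
    where
    inS : Parent _ → Bool
    inS q = does (InS? q π)

  InHho-∑ : ∀ {A : Set} {n} (xs : List A) (f : A → Comb n) → (∀ x → InHho (f x)) → InHho (∑ xs f)
  InHho-∑ xs f heap = Allₚ.concat⁺ (Allₚ.map⁺ (All.universal heap xs))

  module _ {k l : ℕ} (ε : Permutation′ (k +ℕ l)) where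

    InHho-act-product : IsShuffle k l ε → (v : Comb k) (w : Comb l) → InHho v → InHho w → InHho (inv ε ∙ (v · w))
    InHho-act-product shuffle v w heap-v heap-w =
      Allₚ.map⁺ (Allₚ.concat⁺ (Allₚ.map⁺ (All.map (λ {e} → row {e}) heap-v)))
      where
      row : ∀ {e} → HeapOrdered (proj₂ e) →
        All (λ e′ → HeapOrdered (act (inv ε) (proj₂ e′)))
            (concatMap (λ f → (proj₁ e * proj₁ f , proj₂ e ·ᶠ proj₂ f) ∷ []) w)
      row {e} heap-p = Allₚ.concat⁺ (Allₚ.map⁺ (All.map (λ {f} heap-q →
        Product.act-shuffle-heap (proj₂ e) (proj₂ f) heap-p heap-q ε shuffle ∷ []) heap-w))

    Θ-act-product : ∀ π (v : Comb k) (w : Comb l) → InHho v → InHho w →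
      Θcoeff (inv ε ∙ (v · w)) π ≈ Θcoeff v (Blocks.π₁ {k} {l} ε π) * Θcoeff w (Blocks.π₂ {k} {l} ε π)
    Θ-act-product π v w heap-v heap-w = begin
      Θcoeff (inv ε ∙ (v · w)) π              ≡⟨ Θcoeff≡weight (inv ε ∙ (v · w)) π ⟩
      weight inS (inv ε ∙ (v · w))            ≡⟨ weight-act inS (inv ε) (v · w) ⟩
      weight (inS ∘ act (inv ε)) (v · w)
        ≈⟨ weight-product (inS ∘ act (inv ε)) inS₁ inS₂ factors v w heap-v heap-w ⟩
      weight inS₁ v * weight inS₂ w
        ≡⟨ cong₂ _*_ (sym (Θcoeff≡weight v π₁)) (sym (Θcoeff≡weight w π₂)) ⟩
      Θcoeff v π₁ * Θcoeff w π₂               ∎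
      where
      open Blocks {k} {l} ε π

      inS : Parent (k +ℕ l) → Bool
      inS r = does (InS? r π)

      inS₁ : Parent k → Bool
      inS₁ p = does (InS? p π₁)

      inS₂ : Parent l → Bool
      inS₂ q = does (InS? q π₂)

      factors : ∀ p q → HeapOrdered p → HeapOrdered q → inS (act (inv ε) (p ·ᶠ q)) ≡ inS₁ p ∧ inS₂ q
      factors p q heap-p heap-q = does-⇔ (mk⇔ (InS-act-product⇒ p q heap-p heap-q)
                                              (λ (π₁∈S , π₂∈S) → InS-act-product⇐ p q heap-p heap-q π₁∈S π₂∈S))
                                         (InS? (act (inv ε) (p ·ᶠ q)) π) (InS? p π₁ ×-dec InS? q π₂)

  shuffle-count : ∀ {k l} (σ : Permutation′ k) (τ : Permutation′ l) (ε π : Permutation′ (k +ℕ l)) L →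
    EnumeratesShuffles k l L →
    δ (Blocks.π₁ {k} {l} ε π ≈ₚ? inv σ) * δ (Blocks.π₂ {k} {l} ε π ≈ₚ? inv τ)
      ≈ sumOver (λ ζ → δ (π ≈ₚ? inv ((inv ζ ○ (σ ⊗ τ)) ○ ε))) L
  shuffle-count {k} {l} σ τ ε π L (complete , all-shuffles , distinct) =
    by-cases (π₁ ≈ₚ? inv σ) (π₂ ≈ₚ? inv τ)
    where
    open Blocks {k} {l} ε π
    open Matching σ τ ε π

    matches? : ∀ ζ → Dec (Matches ζ)
    matches? ζ = π ≈ₚ? inv ((inv ζ ○ (σ ⊗ τ)) ○ ε)

    none-matches : (∀ ζ → IsShuffle k l ζ → Matches ζ → ⊥) → sumOver (δ ∘ matches?) L ≈ 0#
    none-matches no-match = sum-δ-none Matches matches? L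
      (Allₚ.All¬⇒¬Any (All.map (λ {ζ} → no-match ζ) all-shuffles))

    by-cases : (d₁ : Dec (π₁ ≈ₚ inv σ)) (d₂ : Dec (π₂ ≈ₚ inv τ)) → δ d₁ * δ d₂ ≈ sumOver (δ ∘ matches?) L
    by-cases (yes π₁≈σ⁻¹) (yes π₂≈τ⁻¹) with std⇒matches π₁≈σ⁻¹ π₂≈τ⁻¹
    ... | ζ₀ , shuffle₀ , match₀ = ≈-trans (*-identityˡ 1#) (≈-sym (sum-δ-one Matches matches? matches-unique L distinct
          (Any.map (λ {ζ} ζ₀≈ζ → matches-resp ζ₀ ζ ζ₀≈ζ match₀) (complete ζ₀ shuffle₀))))
    by-cases (yes _) (no π₂≉τ⁻¹) =
      ≈-trans (zeroʳ _) (≈-sym (none-matches λ ζ shuffle m → π₂≉τ⁻¹ (proj₂ (matches⇒std ζ shuffle m))))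
    by-cases (no π₁≉σ⁻¹) _ =
      ≈-trans (zeroˡ _) (≈-sym (none-matches λ ζ shuffle m → π₁≉σ⁻¹ (proj₁ (matches⇒std ζ shuffle m))))

lemma4 : ∀ {c ℓ} (K : Field c ℓ) → let open Lin K in
    (T : ∀ {n} → Permutation′ n → Comb n) → IsT T →
    ∀ (k l : ℕ) (σ : Permutation′ k) (τ : Permutation′ l)
      (ε : Permutation′ (k +ℕ l)) → IsShuffle k l ε →
    (L : List (Permutation′ (k +ℕ l))) → EnumeratesShuffles k l L →
    (inv ε ∙ (T σ · T τ)) ≋ ∑ L (λ ζ → T ((inv ζ ○ (σ ⊗ τ)) ○ ε))
lemma4 K T T-spec k l σ τ ε shuffle L enumeration =
  Θ-injective lhs rhs (InHho-act-product ε shuffle (T σ) (T τ) (heap σ) (heap τ))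
                      (InHho-∑ L (λ ζ → T (ρ ζ)) (λ ζ → heap (ρ ζ)))
    λ π → let open Blocks {k} {l} ε π in begin
      Θcoeff lhs π                            ≈⟨ Θ-act-product ε π (T σ) (T τ) (heap σ) (heap τ) ⟩
      Θcoeff (T σ) π₁ * Θcoeff (T τ) π₂       ≈⟨ *-cong (Θ-T σ π₁) (Θ-T τ π₂) ⟩
      δ (π₁ ≈ₚ? inv σ) * δ (π₂ ≈ₚ? inv τ)     ≈⟨ shuffle-count σ τ ε π L enumeration ⟩
      sumOver (λ ζ → δ (π ≈ₚ? inv (ρ ζ))) L   ≈⟨ sumOver-cong L (λ ζ → ≈-sym (Θ-T (ρ ζ) π)) ⟩
      sumOver (λ ζ → Θcoeff (T (ρ ζ)) π) L    ≈⟨ ≈-sym (Θ-∑ L (λ ζ → T (ρ ζ)) π) ⟩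
      Θcoeff rhs π                            ∎
  where
  open Field K hiding (inverse) renaming (refl to ≈-refl; sym to ≈-sym; trans to ≈-trans)
  open Lin K
  open Linear K
  open import Relation.Binary.Reasoning.Setoid setoid

  heap : ∀ {n} (π : Permutation′ n) → InHho (T π)
  heap π = proj₁ (T-spec π)

  Θ-T : ∀ {n} (π : Permutation′ n) → ΘIs (T π) (inv π)
  Θ-T π = proj₂ (T-spec π)

  ρ : Permutation′ (k +ℕ l) → Permutation′ (k +ℕ l)
  ρ ζ = (inv ζ ○ (σ ⊗ τ)) ○ ε

  lhs rhs : Comb (k +ℕ l)
  lhs = inv ε ∙ (T σ · T τ)
  rhs = ∑ L (λ ζ → T (ρ ζ))
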